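{- Let $D$ be a directed Eulerian spherical embedding whose underlying undirected multigraph $H$ has no loops, no cut-vertices and no 2-edge-cuts. Construct an embedded graph from $D$ as follows: insert a new vertex $z_f$ into the interior of each face $f$ of $D$; then, for each arc $a$ of $D$ from $x$ to $y$, letting $u$ and $w$ be the new vertices inserted in the two faces on either side of $a$, replace $a$ by a black triangular face with vertices $x,u,w$ and a white triangular face with vertices $y,u,w$. Then the resulting face 2-coloured spherical triangulation has a simple underlying graph.
   Context: A directed Eulerian spherical embedding is an embedding in the sphere of a connected digraph (multiple arcs and loops allowed) such that the boundary of every face is a directed closed walk; equivalently, around every vertex the arcs alternate between incoming and outgoing. The construction in the claim produces a triangulation of the sphere whose faces are properly 2-coloured black and white (a face 2-coloured spherical triangulation). A graph is simple if it has no loops and no multiple edges. -}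

module Defs where

open import Data.Nat using (ℕ; zero; suc; _+_; _*_)
open import Data.Fin using (Fin)
open import Data.Fin.Permutation using (Permutation′; _⟨$⟩ʳ_)
open import Data.Bool using (Bool; true; false; not)
open import Data.Product using (Σ; ∃; ∃-syntax; _×_; _,_; proj₁; proj₂)
open import Data.Sum using (_⊎_; inj₁; inj₂)
open import Data.Unit using (⊤)
open import Relation.Nullary using (¬_)
open import Relation.Binary.PropositionalEquality using (_≡_; _≢_)
open import Function.Bundles using (_⇔_)

iter : ∀ {A : Set} → (A → A) → ℕ → A → A
iter f zero    x = x
iter f (suc k) x = f (iter f k x)

-- Combinatorial maps (rotation systems) on a finite set of darts
-- (half-edges) Fin n.  σ is the rotation around vertices, α the
-- fixed-point-free involution pairing the two darts of an edge, and
-- the faces are the orbits of φ = σ ∘ α.  Vertices and faces are given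
-- explicit labels (Fin nV, Fin nF) which must be exactly the orbits.

data MapLinked {n : ℕ} (σ α : Fin n → Fin n) : Fin n → Fin n → Set where
  here  : ∀ {d} → MapLinked σ α d d
  stepσ : ∀ {d e} → MapLinked σ α (σ d) e → MapLinked σ α d e
  stepα : ∀ {d e} → MapLinked σ α (α d) e → MapLinked σ α d e

-- A directed Eulerian spherical embedding, presented as a connected
-- oriented combinatorial map of genus 0 (V - E + F = 2) together with
-- an orientation of each edge (out d = true: d is the tail half of its
-- arc) such that around every vertex arcs alternate in / out.
record DirectedEulerianSphericalEmbedding : Set where
  field
    n      : ℕ                       -- number of darts (= 2 × #arcs)
    σ      : Permutation′ n
    α      : Permutation′ n
    α-invol    : ∀ d → α ⟨$⟩ʳ (α ⟨$⟩ʳ d) ≡ d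
    α-fpf      : ∀ d → α ⟨$⟩ʳ d ≢ d
    nV     : ℕ
    vert   : Fin n → Fin nV
    vert-surj  : ∀ v → ∃[ d ] vert d ≡ v
    vert-orbit : ∀ d d' → (vert d ≡ vert d') ⇔ (∃[ k ] iter (σ ⟨$⟩ʳ_) k d ≡ d')
    nF     : ℕ
    face   : Fin n → Fin nF
    face-surj  : ∀ f → ∃[ d ] face d ≡ f
    face-orbit : ∀ d d' →
      (face d ≡ face d') ⇔ (∃[ k ] iter (λ x → σ ⟨$⟩ʳ (α ⟨$⟩ʳ x)) k d ≡ d')
    connected  : ∀ d d' → MapLinked (σ ⟨$⟩ʳ_) (α ⟨$⟩ʳ_) d d'
    -- Euler's formula V - E + F = 2 with E = n / 2
    spherical  : 2 * (nV + nF) ≡ n + 4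
    out    : Fin n → Bool
    out-α      : ∀ d → out (α ⟨$⟩ʳ d) ≡ not (out d)
    out-σ      : ∀ d → out (σ ⟨$⟩ʳ d) ≡ not (out d)

module _ (D : DirectedEulerianSphericalEmbedding) where
  open DirectedEulerianSphericalEmbedding D

  αf : Fin n → Fin n
  αf d = α ⟨$⟩ʳ d

  -- The underlying undirected multigraph H: vertices Fin nV, one edge
  -- per α-orbit {d, α d} joining vert d and vert (α d).

  data HPath (okV : Fin nV → Set) (okD : Fin n → Set) : Fin nV → Fin nV → Set where
    stop : ∀ {v} → HPath okV okD v v
    go   : ∀ {w} d → okD d → okV (vert (αf d)) →
           HPath okV okD (vert (αf d)) w → HPath okV okD (vert d) w

  HLoopless : Set
  HLoopless = ∀ d → vert d ≢ vert (αf d)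

  CutVertex : Fin nV → Set
  CutVertex x = ∃[ v ] ∃[ w ] (v ≢ x × w ≢ x ×
                  ¬ HPath (λ u → u ≢ x) (λ _ → ⊤) v w)

  NotOneOf : Fin n → Fin n → Fin n → Set
  NotOneOf d₁ d₂ d = d ≢ d₁ × d ≢ αf d₁ × d ≢ d₂ × d ≢ αf d₂

  TwoEdgeCut : Fin n → Fin n → Set
  TwoEdgeCut d₁ d₂ = d₂ ≢ d₁ × d₂ ≢ αf d₁ ×
    ∃[ v ] ∃[ w ] ¬ HPath (λ _ → ⊤) (NotOneOf d₁ d₂) v w

record Multigraph : Set₁ where
  field
    V    : Set
    E    : Set
    ends : E → V × V

SameEnds : ∀ {V : Set} → V × V → V × V → Set
SameEnds (a , b) (c , d) = (a ≡ c × b ≡ d) ⊎ (a ≡ d × b ≡ c)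

Simple : Multigraph → Set
Simple G = (∀ e → proj₁ (ends e) ≢ proj₂ (ends e))
         × (∀ e e' → SameEnds (ends e) (ends e') → e ≡ e')
  where open Multigraph G

-- Vertices: the old vertices (inj₁ v) and one new vertex z_f per face
-- f of D (inj₂ f).  Each arc a = {d, α d} with tail dart d (out d = true)
-- from x = vert d to y = vert (α d) has the faces face d and
-- face (α d) on its two sides (u, w).  The edges of the
-- resulting triangulation (each side shared by exactly two triangles)
-- are:
--   * for each arc (tail dart d): the common side u w of its two
--     triangles, i.e. z_{face d} — z_{face (α d)};
--   * for each corner of D, i.e. each dart c (the corner between
--     σ⁻¹ c and c at vert c, which lies in face c): the side
--     vert c — z_{face c}, shared by the two triangles of the two
--     consecutive arcs at that corner.

triangulationGraph : DirectedEulerianSphericalEmbedding → Multigraph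
triangulationGraph D = record
  { V    = Fin nV ⊎ Fin nF
  ; E    = Fin n ⊎ Σ (Fin n) (λ d → out d ≡ true)
  ; ends = λ { (inj₁ c)       → inj₁ (vert c) , inj₂ (face c)
             ; (inj₂ (d , _)) → inj₂ (face d) , inj₂ (face (α ⟨$⟩ʳ d)) }
  }
  where open DirectedEulerianSphericalEmbedding D

module Submission where

-- The edges of the triangulation T(D) are the spokes  vert c — z_(face c),
-- one for each corner (dart) c of D, and the dual edges
-- z_(face d) — z_(face (α d)), one for each arc with tail dart d.
--
-- A spoke is never a loop, and a dual edge is not a loop because the darts
-- of a face all point the same way (out is φ-invariant) while α reverses out.
-- The same orientation argument rules out parallel edges except in two cases:
--   (A) distinct corners c, c' with the same vertex and the same face, and
--   (B) distinct arcs d, d' with the same ordered pair of side faces.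
-- Both are refuted by one fact of planar duality (Cotree.cotree-no-bypass):
-- for a spanning tree of H, the duals of the non-tree arcs form a tree on
-- the faces, so no such arc can be bypassed by the others.  Connectivity of
-- this dual forest is a maximal-rank argument around a vertex; acyclicity is
-- a count, via Euler's formula and the bound |E| + #components ≥ |V| for
-- edge-list graphs.  Case (B) takes a spanning tree of H − {d, d'} (no
-- 2-edge-cut), where d bypasses d'.  Case (A) takes a spanning tree meeting
-- x = vert c in one edge t (no cut-vertex); walking around x between c and
-- c' then bypasses a non-tree arc at x.  Existence claims about finite data
-- are made classically, in the double-negation monad: every case ends in ⊥.

open import Defs
open import Data.Fin using (Fin)
open import Data.Empty using (⊥)
open import Relation.Nullary using (¬_)

open import Level using (0ℓ)
open import Data.Nat using (ℕ; zero; suc; _+_; _*_; _∸_; _≤_; _<_; s≤s; z<s; _≤?_)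
open import Data.Nat.Properties
open import Data.Nat.Induction using (<-rec)
open import Data.Nat.Solver using (module +-*-Solver)
open import Data.Fin using (zero; suc; punchIn)
open import Data.Fin.Properties using (punchIn-injective; punchInᵢ≢i; injective⇒≤) renaming (_≟_ to _≟F_)
open import Data.Fin.Permutation using (_⟨$⟩ʳ_; _⟨$⟩ˡ_; inverseˡ)
open import Data.Bool using (Bool; true; false; not)
open import Data.Bool.Properties using (not-involutive) renaming (_≟_ to _≟B_)
open import Data.List using (List; []; _∷_; length; lookup; _++_; map; filter; allFin)
open import Data.List.Properties using (length-map; length-tabulate; length-++)
open import Data.List.Membership.Propositional using (_∈_)
open import Data.List.Membership.Propositional.Properties
  using (∈-allFin; ∈-filter⁺; ∈-filter⁻; ∈-map⁺; ∈-map⁻; ∈-++⁻)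
open import Data.List.Relation.Unary.All using (All; _∷_; tabulate)
open import Data.List.Relation.Unary.Any using (here; there; index)
open import Data.List.Relation.Unary.Any.Properties using (lookup-index)
open import Data.List.Relation.Unary.AllPairs using (_∷_)
open import Data.List.Relation.Unary.Unique.Propositional using (Unique)
import Data.List.Relation.Unary.Unique.Propositional.Properties as UniqueP
open import Data.Product using (Σ; ∃; ∃-syntax; _×_; _,_; proj₁; proj₂)
open import Data.Sum using (_⊎_; inj₁; inj₂)
open import Data.Sum.Properties using (inj₁-injective; inj₂-injective)
open import Data.Unit using (⊤; tt)
open import Data.Empty using (⊥-elim)
open import Relation.Nullary using (Dec; yes; no; does; ¬?)
open import Relation.Nullary.Negation using (¬¬-Monad)
open import Relation.Nullary.Decidable using (¬¬-excluded-middle; dec-true; dec-false)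
open import Relation.Binary.PropositionalEquality
open import Relation.Binary.Definitions using (tri<; tri≈; tri>)
open import Axiom.UniquenessOfIdentityProofs using (module Decidable⇒UIP)
open import Effect.Monad using (RawMonad)
open import Function.Bundles using (Equivalence)

iter-+ : ∀ {A : Set} (f : A → A) a b x → iter f (a + b) x ≡ iter f a (iter f b x)
iter-+ f zero    b x = refl
iter-+ f (suc a) b x = cong f (iter-+ f a b x)

-- Arithmetic behind the counting argument: if 1 + c + v arcs are pairwise
-- distinct (2(1 + c + v) ≤ n darts) and V = 1 + v satisfies Euler's formula
-- 2(V + F) = n + 4, then c + 1 < F.
euler-bound : ∀ c v F n → suc (c + v) + suc (c + v) ≤ n → 2 * (suc v + F) ≡ n + 4 → c + 1 < F
euler-bound c v F n arcs euler = *-cancelˡ-≤ 2 (+-cancelʳ-≤ (2 + (v + v)) _ _ chain)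
  where
  open ≤-Reasoning
  open +-*-Solver
  chain : 2 * suc (c + 1) + (2 + (v + v)) ≤ 2 * F + (2 + (v + v))
  chain = begin
    2 * suc (c + 1) + (2 + (v + v))
      ≡⟨ solve 2 (λ c v → con 2 :* (con 1 :+ (c :+ con 1)) :+ (con 2 :+ (v :+ v))
                     := (con 1 :+ (c :+ v)) :+ (con 1 :+ (c :+ v)) :+ con 4) refl c v ⟩
    suc (c + v) + suc (c + v) + 4  ≤⟨ +-monoˡ-≤ 4 arcs ⟩
    n + 4                          ≡⟨ sym euler ⟩
    2 * (suc v + F)
      ≡⟨ solve 2 (λ v F → con 2 :* (con 1 :+ v :+ F) := con 2 :* F :+ (con 2 :+ (v :+ v))) refl v F ⟩
    2 * F + (2 + (v + v))          ∎

module Classical where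
  -- Every final goal is ⊥, so classical existence is used freely in the
  -- double-negation monad.
  open RawMonad (¬¬-Monad {0ℓ}) public using (pure; _>>=_)

  ¬¬-Π : ∀ {N} {P : Fin N → Set} → (∀ i → ¬ ¬ P i) → ¬ ¬ (∀ i → P i)
  ¬¬-Π {zero}          h k = k (λ ())
  ¬¬-Π {suc N} {P} h = do
    p₀ ← h zero
    ps ← ¬¬-Π {N} {λ i → P (suc i)} (λ i → h (suc i))
    pure λ { zero → p₀ ; (suc i) → ps i }

  ¬¬-decide : ∀ {N} (P : Fin N → Set) → ¬ ¬ (∀ i → Dec (P i))
  ¬¬-decide P = ¬¬-Π (λ _ → ¬¬-excluded-middle)

  Least : (ℕ → Set) → ℕ → Set
  Least P m = P m × (∀ j → j < m → ¬ P j)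

  ¬¬-least : (P : ℕ → Set) → ∀ k → P k → ¬ ¬ ∃ (Least P)
  ¬¬-least P = <-rec (λ k → P k → ¬ ¬ ∃ (Least P)) step
    where
    step : ∀ k → (∀ {j} → j < k → P j → ¬ ¬ ∃ (Least P)) → P k → ¬ ¬ ∃ (Least P)
    step k smaller pk = do
      yes (j , j<k , pj) ← ¬¬-excluded-middle {A = ∃[ j ] (j < k × P j)}
        where no none → pure (k , pk , λ j j<k pj → none (j , j<k , pj))
      smaller j<k pj

module Finite where
  lookup-injective : ∀ {A : Set} {xs : List A} → Unique xs →
    ∀ i j → lookup xs i ≡ lookup xs j → i ≡ j
  lookup-injective (_ ∷ _) zero    zero    e = refl
  lookup-injective (a ∷ _) zero    (suc j) e = ⊥-elim (all-lookup a j e)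
    where
    all-lookup : ∀ {A : Set} {P : A → Set} {xs : List A} → All P xs → ∀ i → P (lookup xs i)
    all-lookup (px ∷ _)  zero    = px
    all-lookup (_  ∷ ps) (suc i) = all-lookup ps i
  lookup-injective (a ∷ u) (suc i) zero    e = sym (lookup-injective (a ∷ u) zero (suc i) (sym e))
  lookup-injective (_ ∷ u) (suc i) (suc j) e = cong suc (lookup-injective u i j e)

  unique⇒length≤ : ∀ {N} {xs : List (Fin N)} → Unique xs → length xs ≤ N
  unique⇒length≤ u = injective⇒≤ (λ {i} {j} → lookup-injective u i j)

  unique-++-map : ∀ {X : Set} {A : List X} {f : X → X} → Unique A →
    (∀ {x y} → f x ≡ f y → x ≡ y) → (∀ x y → x ∈ A → y ∈ A → x ≢ f y) →
    Unique (A ++ map f A)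
  unique-++-map uA f-inj off = UniqueP.++⁺ uA (UniqueP.map⁺ f-inj uA)
    λ { (mx , my) → let (y , yA , e) = ∈-map⁻ _ my in off _ y mx yA e }

  nonempty : ∀ {N} → Fin N → ∃[ m ] (N ≡ suc m)
  nonempty {suc m} _ = m , refl

  imageExcept : ∀ {N} {X : Set} (r : Fin N) (g : Fin N → X) →
    (∀ u v → u ≢ r → v ≢ r → g u ≡ g v → u ≡ v) →
    Σ (List X) λ L → length L ≡ N ∸ 1 × Unique L × (∀ x → x ∈ L → ∃[ v ] (v ≢ r × x ≡ g v))
  imageExcept {suc m} r g g-inj =
    map (λ i → g (punchIn r i)) (allFin m) ,
    trans (length-map _ (allFin m)) (length-tabulate (λ i → i)) ,
    UniqueP.map⁺ (λ {i} {j} e → punchIn-injective r i j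
                    (g-inj _ _ (punchInᵢ≢i r i) (punchInᵢ≢i r j) e)) (UniqueP.allFin⁺ m) ,
    λ x mem → let (i , _ , e) = ∈-map⁻ (λ i → g (punchIn r i)) mem in punchIn r i , punchInᵢ≢i r i , e

  maximal : ∀ {A : Set} (μ : A → ℕ) (P : A → Set) → (∀ a → Dec (P a)) →
    ∀ a₀ → P a₀ → (xs : List A) → ∃[ a ] (P a × ∀ b → b ∈ xs → P b → μ b ≤ μ a)
  maximal μ P P? a₀ p₀ [] = a₀ , p₀ , λ _ ()
  maximal μ P P? a₀ p₀ (x ∷ xs) with maximal μ P P? a₀ p₀ xs | P? x
  ... | a , pa , best | no ¬px = a , pa , λ { _ (here refl) px → ⊥-elim (¬px px) ; b (there m) → best b m }
  ... | a , pa , best | yes px with μ x ≤? μ a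
  ...   | yes x≤a = a , pa , λ { _ (here refl) _ → x≤a ; b (there m) → best b m }
  ...   | no x≰a  = x , px , λ { _ (here refl) _ → ≤-refl
                                ; b (there m) pb → ≤-trans (best b m pb) (<⇒≤ (≰⇒> x≰a)) }

module EdgeListGraph where
  open Classical

  data Path {N : ℕ} (es : List (Fin N × Fin N)) : Fin N → Fin N → Set where
    stop : ∀ {v} → Path es v v
    fwd  : ∀ {a b w} → (a , b) ∈ es → Path es b w → Path es a w
    bwd  : ∀ {a b w} → (a , b) ∈ es → Path es a w → Path es b w

  _++P_ : ∀ {N es} {u v w : Fin N} → Path es u v → Path es v w → Path es u w
  stop    ++P q = q
  fwd m p ++P q = fwd m (p ++P q)
  bwd m p ++P q = bwd m (p ++P q)

  reverseP : ∀ {N es} {u v : Fin N} → Path es u v → Path es v u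
  reverseP stop      = stop
  reverseP (fwd m p) = reverseP p ++P bwd m stop
  reverseP (bwd m p) = reverseP p ++P fwd m stop

  path-[] : ∀ {N} {w r : Fin N} → Path [] w r → w ≡ r
  path-[] stop = refl

  before-first-use : ∀ {N} {a b : Fin N} {es w r} → Path ((a , b) ∷ es) w r →
    Path es w r ⊎ Path es w a ⊎ Path es w b
  before-first-use stop                = inj₁ stop
  before-first-use (fwd (here refl) _) = inj₂ (inj₁ stop)
  before-first-use (bwd (here refl) _) = inj₂ (inj₂ stop)
  before-first-use (fwd (there m) p) with before-first-use p
  ... | inj₁ q        = inj₁ (fwd m q)
  ... | inj₂ (inj₁ q) = inj₂ (inj₁ (fwd m q))
  ... | inj₂ (inj₂ q) = inj₂ (inj₂ (fwd m q))
  before-first-use (bwd (there m) p) with before-first-use p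
  ... | inj₁ q        = inj₁ (bwd m q)
  ... | inj₂ (inj₁ q) = inj₂ (inj₁ (bwd m q))
  ... | inj₂ (inj₂ q) = inj₂ (inj₂ (bwd m q))

  after-last-use : ∀ {N} {a b : Fin N} {es w r} → Path ((a , b) ∷ es) w r →
    Path es w r ⊎ Path es a r ⊎ Path es b r
  after-last-use stop = inj₁ stop
  after-last-use (fwd (here refl) p) with after-last-use p
  ... | inj₁ q = inj₂ (inj₂ q)
  ... | inj₂ x = inj₂ x
  after-last-use (bwd (here refl) p) with after-last-use p
  ... | inj₁ q = inj₂ (inj₁ q)
  ... | inj₂ x = inj₂ x
  after-last-use (fwd (there m) p) with after-last-use p
  ... | inj₁ q = inj₁ (fwd m q)
  ... | inj₂ x = inj₂ x
  after-last-use (bwd (there m) p) with after-last-use p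
  ... | inj₁ q = inj₁ (bwd m q)
  ... | inj₂ x = inj₂ x

  Reach : ∀ {N} → List (Fin N × Fin N) → List (Fin N) → Fin N → Set
  Reach es R w = ∃[ r ] (r ∈ R × Path es w r)

  -- Induction on es:
  -- after deleting the first edge (a , b), either b still reaches a root and
  -- a can serve as a new root, or b itself must become one.
  reaching⇒enough-edges : ∀ {N} (es : List (Fin N × Fin N)) (R : List (Fin N)) →
    (∀ w → ¬ ¬ Reach es R w) → ¬ (length es + length R < N)
  reaching⇒enough-edges {N} [] R reach small =
    ¬¬-Π (λ w → reach w >>= λ { (r , m , p) → pure (subst (_∈ R) (sym (path-[] p)) m) })
      (λ inR → <⇒≱ small (injective⇒≤ {f = λ w → index (inR w)} (λ {i} {j} e →
         trans (lookup-index (inR i)) (trans (cong (lookup R) e) (sym (lookup-index (inR j)))))))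
  reaching⇒enough-edges {N} ((a , b) ∷ es) R reach small = ¬¬-excluded-middle {A = Reach es R b} λ
    { (yes b-reaches) → reaching⇒enough-edges es (a ∷ R)
        (λ w → reach w >>= λ { (r , m , p) → pure (via-a b-reaches r m p) }) fewer
    ; (no b-isolated) → reaching⇒enough-edges es (b ∷ R)
        (λ w → reach w >>= λ { (r , m , p) → via-b b-isolated r m p }) fewer }
    where
    fewer : length es + suc (length R) < N
    fewer = subst (_< N) (sym (+-suc (length es) (length R))) small

    via-a : ∀ {w} → Reach es R b → ∀ r → r ∈ R → Path ((a , b) ∷ es) w r → Reach es (a ∷ R) w
    via-a (r' , m' , q') r m p with before-first-use p
    ... | inj₁ q        = r , there m , q
    ... | inj₂ (inj₁ q) = a , here refl , q
    ... | inj₂ (inj₂ q) = r' , there m' , (q ++P q')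

    via-b : ∀ {w} → ¬ Reach es R b → ∀ r → r ∈ R → Path ((a , b) ∷ es) w r → ¬ ¬ Reach es (b ∷ R) w
    via-b b-isolated r m p with before-first-use p
    ... | inj₁ q        = pure (r , there m , q)
    ... | inj₂ (inj₂ q) = pure (b , here refl , q)
    ... | inj₂ (inj₁ q) = reach a >>= λ { (r' , m' , p') → pure (from-a r' m' (after-last-use p')) }
      where
      from-a : ∀ r' → r' ∈ R → Path es a r' ⊎ Path es a r' ⊎ Path es b r' → Reach es (b ∷ R) _
      from-a r' m' (inj₁ q')        = r' , there m' , (q ++P q')
      from-a r' m' (inj₂ (inj₁ q')) = r' , there m' , (q ++P q')
      from-a r' m' (inj₂ (inj₂ q')) = ⊥-elim (b-isolated (r' , m' , q'))

module Map (D : DirectedEulerianSphericalEmbedding) where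
  open DirectedEulerianSphericalEmbedding D
  open Classical
  open Finite
  open EdgeListGraph

  σ' : Fin n → Fin n
  σ' d = σ ⟨$⟩ʳ d

  α' : Fin n → Fin n
  α' = αf D

  σ-injective : ∀ {a b} → σ' a ≡ σ' b → a ≡ b
  σ-injective e = trans (sym (inverseˡ σ)) (trans (cong (σ ⟨$⟩ˡ_) e) (inverseˡ σ))

  iterσ-injective : ∀ i {a b} → iter σ' i a ≡ iter σ' i b → a ≡ b
  iterσ-injective zero    e = e
  iterσ-injective (suc i) e = iterσ-injective i (σ-injective e)

  α-injective : ∀ {a b} → α' a ≡ α' b → a ≡ b
  α-injective {a} {b} e = trans (sym (α-invol a)) (trans (cong α' e) (α-invol b))

  α-swap : ∀ {a b} → α' a ≡ b → a ≡ α' b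
  α-swap {a} e = trans (sym (α-invol a)) (cong α' e)

  tail-α : ∀ c → out c ≡ true → out (α' c) ≡ false
  tail-α c e = trans (out-α c) (cong not e)

  head-α : ∀ c → out c ≢ true → out (α' c) ≡ true
  head-α c ¬tail with out c | out-α c
  ... | true  | _ = ⊥-elim (¬tail refl)
  ... | false | e = e

  tail≢α-tail : ∀ d d' → out d ≡ true → out d' ≡ true → d ≢ α' d'
  tail≢α-tail d d' tail tail' e with trans (sym tail) (trans (cong out e) (tail-α d' tail'))
  ... | ()

  -- Faces are directed closed walks: φ = σ ∘ α preserves the orientation
  -- bit, so all darts of a face point the same way.
  out-iterφ : ∀ k c → out (iter (λ x → σ' (α' x)) k c) ≡ out c
  out-iterφ zero    c = refl
  out-iterφ (suc k) c = begin
    out (σ' (α' c'))  ≡⟨ out-σ (α' c') ⟩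
    not (out (α' c')) ≡⟨ cong not (out-α c') ⟩
    not (not (out c')) ≡⟨ not-involutive (out c') ⟩
    out c'            ≡⟨ out-iterφ k c ⟩
    out c             ∎
    where
    open ≡-Reasoning
    c' : Fin n
    c' = iter (λ x → σ' (α' x)) k c

  face-out : ∀ c c' → face c ≡ face c' → out c ≡ out c'
  face-out c c' same with Equivalence.to (face-orbit c c') same
  ... | k , e = trans (sym (out-iterφ k c)) (cong out e)

  tail-faces-differ : ∀ d d' → out d ≡ true → out d' ≡ true → face d ≢ face (α' d')
  tail-faces-differ d d' tail tail' same with
    trans (sym tail) (trans (face-out d (α' d') same) (tail-α d' tail'))
  ... | ()

  face-ασ : ∀ c → face (α' c) ≡ face (σ' c)
  face-ασ c = Equivalence.from (face-orbit (α' c) (σ' c)) (1 , cong σ' (α-invol c))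

  vert-σ : ∀ c → vert (σ' c) ≡ vert c
  vert-σ c = sym (Equivalence.from (vert-orbit c (σ' c)) (1 , refl))

  vert-iter : ∀ k c → vert (iter σ' k c) ≡ vert c
  vert-iter zero    c = refl
  vert-iter (suc k) c = trans (vert-σ (iter σ' k c)) (vert-iter k c)

  record FirstReturn (t : Fin n) : Set where
    field
      period  : ℕ
      returns : iter σ' period (σ' t) ≡ t
      fresh   : ∀ j → j < period → iter σ' j (σ' t) ≢ t

  ¬¬-firstReturn : ∀ t → ¬ ¬ FirstReturn t
  ¬¬-firstReturn t = do
    (r , hr , before) ← ¬¬-least (λ k → iter σ' k (σ' t) ≡ t) (proj₁ back) (proj₂ back)
    pure (record { period = r ; returns = hr ; fresh = before })
    where
    back : ∃[ k ] iter σ' k (σ' t) ≡ t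
    back = Equivalence.to (vert-orbit (σ' t) t) (vert-σ t)

  module Around {t : Fin n} (fr : FirstReturn t) where
    open FirstReturn fr

    s : Fin n
    s = σ' t

    reduce : ∀ k → ∃[ a ] (a ≤ period × iter σ' a s ≡ iter σ' k s)
    reduce = <-rec _ step
      where
      step : ∀ k → (∀ {j} → j < k → ∃[ a ] (a ≤ period × iter σ' a s ≡ iter σ' j s)) →
             ∃[ a ] (a ≤ period × iter σ' a s ≡ iter σ' k s)
      step k smaller with k ≤? period
      ... | yes k≤p = k , k≤p , refl
      ... | no k≰p with smaller (∸-monoʳ-< z<s (≰⇒> k≰p))
      ...   | a , a≤p , e = a , a≤p , trans e (sym one-turn)
        where
        open ≡-Reasoning
        one-turn : iter σ' k s ≡ iter σ' (k ∸ suc period) s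
        one-turn = begin
          iter σ' k s
            ≡⟨ cong (λ z → iter σ' z s) (sym (m∸n+n≡m {k} {suc period} (≰⇒> k≰p))) ⟩
          iter σ' (k ∸ suc period + suc period) s
            ≡⟨ iter-+ σ' (k ∸ suc period) (suc period) s ⟩
          iter σ' (k ∸ suc period) (σ' (iter σ' period s))
            ≡⟨ cong (λ z → iter σ' (k ∸ suc period) (σ' z)) returns ⟩
          iter σ' (k ∸ suc period) s ∎

    distinct : ∀ i j → i < j → j ≤ period → iter σ' i s ≢ iter σ' j s
    distinct i j i<j j≤p e = fresh (period ∸ m) (∸-monoʳ-< 0<m m≤p) back-at-t
      where
      open ≡-Reasoning
      m : ℕ
      m = j ∸ i
      0<m : 0 < m
      0<m = subst (_< m) (n∸n≡0 i) (∸-monoˡ-< i<j ≤-refl)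
      m≤p : m ≤ period
      m≤p = ≤-trans (m∸n≤m j i) j≤p
      s-periodic : s ≡ iter σ' m s
      s-periodic = iterσ-injective i (begin
        iter σ' i s            ≡⟨ e ⟩
        iter σ' j s            ≡⟨ cong (λ z → iter σ' z s) (sym (m∸n+n≡m {j} {i} (<⇒≤ i<j))) ⟩
        iter σ' (m + i) s      ≡⟨ cong (λ z → iter σ' z s) (+-comm m i) ⟩
        iter σ' (i + m) s      ≡⟨ iter-+ σ' i m s ⟩
        iter σ' i (iter σ' m s) ∎)
      back-at-t : iter σ' (period ∸ m) s ≡ t
      back-at-t = begin
        iter σ' (period ∸ m) s              ≡⟨ cong (iter σ' (period ∸ m)) s-periodic ⟩
        iter σ' (period ∸ m) (iter σ' m s)  ≡⟨ sym (iter-+ σ' (period ∸ m) m s) ⟩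
        iter σ' (period ∸ m + m) s          ≡⟨ cong (λ z → iter σ' z s) (m∸n+n≡m m≤p) ⟩
        iter σ' period s                    ≡⟨ returns ⟩
        t                                   ∎

    at-vertex : ∀ i → vert (iter σ' i s) ≡ vert t
    at-vertex i = trans (vert-iter i s) (vert-σ t)

    around-constant : ∀ {X : Set} (g : Fin n → X) →
      (∀ c → vert c ≡ vert t → c ≢ t → g c ≡ g (σ' c)) → g s ≡ g t
    around-constant g step = trans (walk period ≤-refl) (cong g returns)
      where
      walk : ∀ i → i ≤ period → g s ≡ g (iter σ' i s)
      walk zero    _  = refl
      walk (suc i) le = trans (walk i (<⇒≤ le)) (step (iter σ' i s) (at-vertex i) (fresh i le))

  data DPath (Q : Fin n → Set) : Fin nF → Fin nF → Set where
    dstop : ∀ {f} → DPath Q f f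
    dfwd  : ∀ {g} c → Q c → DPath Q (face (α' c)) g → DPath Q (face c) g
    dbwd  : ∀ {g} c → Q c → DPath Q (face c) g → DPath Q (face (α' c)) g

  _++D_ : ∀ {Q f g h} → DPath Q f g → DPath Q g h → DPath Q f h
  dstop      ++D q = q
  dfwd c x p ++D q = dfwd c x (p ++D q)
  dbwd c x p ++D q = dbwd c x (p ++D q)

  reverseD : ∀ {Q f g} → DPath Q f g → DPath Q g f
  reverseD dstop        = dstop
  reverseD (dfwd c x p) = reverseD p ++D dbwd c x dstop
  reverseD (dbwd c x p) = reverseD p ++D dfwd c x dstop

  mapD : ∀ {Q Q' : Fin n → Set} → (∀ c → Q c → Q' c) → ∀ {f g} → DPath Q f g → DPath Q' f g
  mapD h dstop        = dstop
  mapD h (dfwd c q p) = dfwd c (h c q) (mapD h p)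
  mapD h (dbwd c q p) = dbwd c (h c q) (mapD h p)

  record SpanningTree : Set where
    field
      root        : Fin nV
      parent      : Fin nV → Fin n
      rank        : Fin nV → ℕ
      parent-at   : ∀ v → v ≢ root → vert (parent v) ≡ v
      parent-rank : ∀ v → v ≢ root → rank (vert (α' (parent v))) < rank v

  Bypass : (Fin n → Set) → Fin n → Fin n → Set
  Bypass Q c₀ c = Q c × c ≢ c₀ × c ≢ α' c₀

  module Cotree (tree : SpanningTree) where
    open SpanningTree tree

    TreeDart : Fin n → Set
    TreeDart c = ∃[ v ] (v ≢ root × (c ≡ parent v ⊎ c ≡ α' (parent v)))

    Cotree : Fin n → Set
    Cotree c = ¬ TreeDart c

    cotree-α : ∀ c → Cotree c → Cotree (α' c)
    cotree-α c cot (v , vr , inj₁ e) = cot (v , vr , inj₂ (α-swap e))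
    cotree-α c cot (v , vr , inj₂ e) = cot (v , vr , inj₁ (α-injective e))

    parent-injective : ∀ u v → u ≢ root → v ≢ root → parent u ≡ parent v → u ≡ v
    parent-injective u v ur vr e = trans (sym (parent-at u ur)) (trans (cong vert e) (parent-at v vr))

    -- Two parent darts never form one arc: ranks would decrease both ways.
    parent≢α-parent : ∀ u v → u ≢ root → v ≢ root → parent v ≢ α' (parent u)
    parent≢α-parent u v ur vr e = <-asym (below u ur v e₁) (below v vr u e₂)
      where
      below : ∀ w → w ≢ root → ∀ z → vert (α' (parent w)) ≡ z → rank z < rank w
      below w wr z e' = subst (λ y → rank y < rank w) e' (parent-rank w wr)
      e₁ : vert (α' (parent u)) ≡ v
      e₁ = trans (cong vert (sym e)) (parent-at v vr)
      e₂ : vert (α' (parent v)) ≡ u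
      e₂ = trans (cong vert (trans (cong α' e) (α-invol (parent u)))) (parent-at u ur)

    -- Colour each face by whether it reaches f₀ across cotree darts; an arc
    -- is separating if its two sides get different colours.
    module FaceSides (f₀ : Fin nF) (reaches? : ∀ g → Dec (DPath Cotree g f₀)) where
      side : Fin nF → Bool
      side g = does (reaches? g)

      Separating : Fin n → Set
      Separating c = side (face c) ≢ side (face (α' c))

      separating-α : ∀ c → Separating c → Separating (α' c)
      separating-α c sep e = sep (sym (trans e (cong (λ z → side (face z)) (α-invol c))))

      cotree-side : ∀ c → Cotree c → side (face c) ≡ side (face (α' c))
      cotree-side c cot with reaches? (face c) | reaches? (face (α' c))
      ... | yes _ | yes _ = refl
      ... | no  _ | no  _ = refl
      ... | yes r | no ¬r = ⊥-elim (¬r (dbwd c cot r))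
      ... | no ¬r | yes r = ⊥-elim (¬r (dfwd c cot r))

      separating⇒tree : ∀ c → Separating c → ¬ ¬ TreeDart c
      separating⇒tree c sep cot = sep (cotree-side c cot)

      parent-separating : ∀ c v → (c ≡ parent v ⊎ c ≡ α' (parent v)) → Separating c →
        Separating (parent v)
      parent-separating c v (inj₁ e) sep = subst Separating e sep
      parent-separating c v (inj₂ e) sep = subst Separating (sym (α-swap (sym e))) (separating-α c sep)

      separating-exists : ∀ {d e} → MapLinked σ' α' d e → side (face d) ≢ side (face e) → ∃ Separating
      separating-exists here ne = ⊥-elim (ne refl)
      separating-exists {d} (stepσ l) ne with side (face d) ≟B side (face (α' d))
      ... | no sep = d , sep
      ... | yes eq = separating-exists l (λ e' → ne (trans eq (trans (cong side (face-ασ d)) e')))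
      separating-exists {d} (stepα l) ne with side (face d) ≟B side (face (α' d))
      ... | no sep = d , sep
      ... | yes eq = separating-exists l (λ e' → ne (trans eq e'))

      -- A separating parent dart p v of maximal rank is impossible: every other
      -- dart at v is non-separating (it is cotree, or the parent dart of a
      -- child of larger rank), so walking around v the colour of the face
      -- does not change, yet p v itself separates.
      no-maximal-separating : ∀ v → v ≢ root → Separating (parent v) →
        (∀ u → u ≢ root → Separating (parent u) → rank u ≤ rank v) → ⊥
      no-maximal-separating v vr sep maximal-v = ¬¬-firstReturn (parent v) λ fr →
        sep (sym (trans (cong side (face-ασ (parent v)))
                        (Around.around-constant fr (λ c → side (face c)) preserved)))
        where
        at-v : ∀ c → vert c ≡ vert (parent v) → vert c ≡ v
        at-v c e = trans e (parent-at v vr)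

        not-separating : ∀ c → vert c ≡ vert (parent v) → c ≢ parent v → ¬ Separating c
        not-separating c c-at c≢p sep-c = separating⇒tree c sep-c λ where
          (u , ur , inj₁ e) → c≢p (trans e (cong parent
            (trans (sym (parent-at u ur)) (trans (cong vert (sym e)) (at-v c c-at)))))
          (u , ur , inj₂ e) → <⇒≱
            (subst (λ z → rank z < rank u) (trans (cong vert (sym e)) (at-v c c-at)) (parent-rank u ur))
            (maximal-v u ur (parent-separating c u (inj₂ e) sep-c))

        preserved : ∀ c → vert c ≡ vert (parent v) → c ≢ parent v → side (face c) ≡ side (face (σ' c))
        preserved c c-at c≢p with side (face c) ≟B side (face (α' c))
        ... | yes same  = trans same (cong side (face-ασ c))
        ... | no  sep-c = ⊥-elim (not-separating c c-at c≢p sep-c)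

      SeparatingParent : Fin nV → Set
      SeparatingParent v = v ≢ root × Separating (parent v)

      separatingParent? : ∀ u → Dec (SeparatingParent u)
      separatingParent? u with u ≟F root | side (face (parent u)) ≟B side (face (α' (parent u)))
      ... | yes ur | _        = no (λ sp → proj₁ sp ur)
      ... | no ur  | yes same = no (λ sp → proj₂ sp same)
      ... | no ur  | no sep   = yes (ur , sep)

      no-separating-parent : ∀ v → ¬ SeparatingParent v
      no-separating-parent v sp with maximal rank SeparatingParent separatingParent? v sp (allFin nV)
      ... | w , (wr , sep-w) , best =
        no-maximal-separating w wr sep-w (λ u ur sep-u → best u (∈-allFin u) (ur , sep-u))

      all-reach : ∀ g → ¬ ¬ DPath Cotree g f₀
      all-reach g ¬reach = separating⇒tree c sep λ where
          (v , vr , at) → no-separating-parent v (vr , parent-separating c v at sep)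
        where
        d₀ d : Fin n
        d₀ = proj₁ (face-surj f₀)
        d  = proj₁ (face-surj g)

        d₀-reaches : DPath Cotree (face d₀) f₀
        d₀-reaches = subst (λ z → DPath Cotree z f₀) (sym (proj₂ (face-surj f₀))) dstop

        d-stuck : ¬ DPath Cotree (face d) f₀
        d-stuck r = ¬reach (subst (λ z → DPath Cotree z f₀) (proj₂ (face-surj g)) r)

        colours-differ : side (face d₀) ≢ side (face d)
        colours-differ e with trans (sym (dec-true (reaches? (face d₀)) d₀-reaches))
                                    (trans e (dec-false (reaches? (face d)) d-stuck))
        ... | ()

        separating-arc : ∃ Separating
        separating-arc = separating-exists (connected d₀ d) colours-differ

        c : Fin n
        c = proj₁ separating-arc

        sep : Separating c
        sep = proj₂ separating-arc

    cotree-connected : ∀ f₀ g → ¬ ¬ DPath Cotree g f₀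
    cotree-connected f₀ g ¬reach = ¬¬-decide (λ g' → DPath Cotree g' f₀) λ reaches? →
      FaceSides.all-reach f₀ reaches? g ¬reach

    -- Counting arcs with Euler's formula: the cotree arcs other than a tail
    -- dart c₀ are too few to connect all faces, so c₀ cannot be bypassed.
    module Counting (treeDart? : ∀ c → Dec (TreeDart c)) (c₀ : Fin n) (tail₀ : out c₀ ≡ true)
                    (cot₀ : Cotree c₀) where
      OtherTail : Fin n → Set
      OtherTail c = out c ≡ true × Cotree c × c ≢ c₀

      otherTail? : ∀ c → Dec (OtherTail c)
      otherTail? c with out c ≟B true | treeDart? c | c ≟F c₀
      ... | no ¬tail | _       | _     = no (λ x → ¬tail (proj₁ x))
      ... | yes _    | yes tr  | _     = no (λ x → proj₁ (proj₂ x) tr)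
      ... | yes _    | no _    | yes e = no (λ x → proj₂ (proj₂ x) e)
      ... | yes tail | no cot  | no ne = yes (tail , cot , ne)

      others : List (Fin n)
      others = filter otherTail? (allFin n)

      parents : Σ (List (Fin n)) λ L → length L ≡ nV ∸ 1 × Unique L ×
                  (∀ x → x ∈ L → ∃[ v ] (v ≢ root × x ≡ parent v))
      parents = imageExcept root parent parent-injective

      arcs : List (Fin n)
      arcs = (c₀ ∷ others) ++ proj₁ parents

      Representative : Fin n → Set
      Representative x = (out x ≡ true × Cotree x) ⊎ (∃[ v ] (v ≢ root × x ≡ parent v))

      representative : ∀ x → x ∈ arcs → Representative x
      representative x m with ∈-++⁻ (c₀ ∷ others) m
      ... | inj₁ (here refl) = inj₁ (tail₀ , cot₀)
      ... | inj₁ (there m')  = let (_ , (tail , cot , _)) = ∈-filter⁻ otherTail? {xs = allFin n} m'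
                               in inj₁ (tail , cot)
      ... | inj₂ m'          = inj₂ (proj₂ (proj₂ (proj₂ parents)) x m')

      representatives-apart : ∀ x y → Representative x → Representative y → x ≢ α' y
      representatives-apart x y (inj₁ (tail , _)) (inj₁ (tail' , _)) = tail≢α-tail x y tail tail'
      representatives-apart x y (inj₁ (_ , cot)) (inj₂ (v , vr , e')) e =
        cot (v , vr , inj₂ (trans e (cong α' e')))
      representatives-apart x y (inj₂ (v , vr , e')) (inj₁ (_ , cot)) e =
        cot (v , vr , inj₂ (α-swap (trans (sym e) e')))
      representatives-apart x y (inj₂ (v , vr , e')) (inj₂ (u , ur , e'')) e =
        parent≢α-parent u v ur vr (trans (sym e') (trans e (cong α' e'')))

      arcs-unique : Unique arcs
      arcs-unique = UniqueP.++⁺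
        (tabulate (λ m e → proj₂ (proj₂ (proj₂ (∈-filter⁻ otherTail? {xs = allFin n} m))) (sym e))
          ∷ UniqueP.filter⁺ otherTail? (UniqueP.allFin⁺ n))
        (proj₁ (proj₂ (proj₂ parents)))
        λ { {x} (m , m') → tree-and-cotree x m (proj₂ (proj₂ (proj₂ parents)) x m') }
        where
        tree-and-cotree : ∀ x → x ∈ c₀ ∷ others → ∃[ v ] (v ≢ root × x ≡ parent v) → ⊥
        tree-and-cotree x (here refl) (v , vr , e) = cot₀ (v , vr , inj₁ e)
        tree-and-cotree x (there m)   (v , vr , e) =
          proj₁ (proj₂ (proj₂ (∈-filter⁻ otherTail? {xs = allFin n} m))) (v , vr , inj₁ e)

      -- 2 (1 + |others| + (V − 1)) ≤ n, so by Euler's formula |others| + 1 < F.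
      few-others : length others + 1 < nF
      few-others = euler-bound (length others) v nF n darts
                     (subst (λ z → 2 * (z + nF) ≡ n + 4) V≡ spherical)
        where
        v : ℕ
        v = proj₁ (nonempty root)

        V≡ : nV ≡ suc v
        V≡ = proj₂ (nonempty root)
        length-arcs : length arcs ≡ suc (length others + v)
        length-arcs = cong suc (trans (length-++ others)
                        (cong (length others +_) (trans (proj₁ (proj₂ parents)) (cong (_∸ 1) V≡))))
        darts : suc (length others + v) + suc (length others + v) ≤ n
        darts = subst (_≤ n)
          (trans (length-++ arcs) (cong₂ _+_ length-arcs (trans (length-map α' arcs) length-arcs)))
          (unique⇒length≤ (unique-++-map arcs-unique α-injective
            (λ x y mx my → representatives-apart x y (representative x mx) (representative y my))))

      dualEdges : List (Fin nF × Fin nF)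
      dualEdges = map (λ c → face c , face (α' c)) others

      bypass-edge : ∀ c → Bypass Cotree c₀ c → Path dualEdges (face c) (face (α' c))
      bypass-edge c (cot , ne , ne') with out c ≟B true
      ... | yes tail = fwd (∈-map⁺ _ (∈-filter⁺ otherTail? (∈-allFin c) (tail , cot , ne))) stop
      ... | no ¬tail = subst (λ z → Path dualEdges (face z) (face (α' c))) (α-invol c)
                         (bwd (∈-map⁺ _ (∈-filter⁺ otherTail? (∈-allFin (α' c)) other)) stop)
        where
        other : OtherTail (α' c)
        other = head-α c ¬tail , cotree-α c cot , λ e → ne' (α-swap e)

      bypass-path : ∀ {f g} → DPath (Bypass Cotree c₀) f g → Path dualEdges f g
      bypass-path dstop        = stop
      bypass-path (dfwd c q p) = bypass-edge c q ++P bypass-path p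
      bypass-path (dbwd c q p) = reverseP (bypass-edge c q) ++P bypass-path p

      -- With a bypass of c₀, every face would reach face c₀ along dualEdges.
      no-bypass : ¬ DPath (Bypass Cotree c₀) (face c₀) (face (α' c₀))
      no-bypass byp = reaching⇒enough-edges dualEdges (face c₀ ∷ []) reach
                        (subst (λ z → z + 1 < nF) (sym (length-map _ others)) few-others)
        where
        reroute : ∀ c → Cotree c → DPath (Bypass Cotree c₀) (face c) (face (α' c))
        reroute c cot with c ≟F c₀ | c ≟F α' c₀
        ... | yes refl | _        = byp
        ... | no _     | yes refl =
          subst (λ z → DPath (Bypass Cotree c₀) (face (α' c₀)) (face z)) (sym (α-invol c₀)) (reverseD byp)
        ... | no ne    | no ne'   = dfwd c (cot , ne , ne') dstop

        avoid : ∀ {f g} → DPath Cotree f g → DPath (Bypass Cotree c₀) f g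
        avoid dstop          = dstop
        avoid (dfwd c cot p) = reroute c cot ++D avoid p
        avoid (dbwd c cot p) = reverseD (reroute c cot) ++D avoid p

        reach : ∀ w → ¬ ¬ Reach dualEdges (face c₀ ∷ []) w
        reach w = do
          p ← cotree-connected (face c₀) w
          pure (face c₀ , here refl , bypass-path (avoid p))

    cotree-no-bypass : ∀ c₀ → Cotree c₀ → ¬ DPath (Bypass Cotree c₀) (face c₀) (face (α' c₀))
    cotree-no-bypass c₀ cot₀ byp = ¬¬-decide TreeDart oriented
      where
      -- Bypass of the reversed arc, for when c₀ is a head dart.
      flipped : DPath (Bypass Cotree (α' c₀)) (face (α' c₀)) (face (α' (α' c₀)))
      flipped = subst (λ z → DPath (Bypass Cotree (α' c₀)) (face (α' c₀)) (face z)) (sym (α-invol c₀))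
        (reverseD (mapD (λ c (cot , ne , ne') → cot , ne' , λ e → ne (trans e (α-invol c₀))) byp))

      oriented : (∀ c → Dec (TreeDart c)) → ⊥
      oriented treeDart? with out c₀ ≟B true
      ... | yes tail = Counting.no-bypass treeDart? c₀ tail cot₀ byp
      ... | no ¬tail = Counting.no-bypass treeDart? (α' c₀) (head-α c₀ ¬tail) (cotree-α c₀ cot₀) flipped

  module BFS (okV : Fin nV → Set) (okD : Fin n → Set) (okV? : ∀ v → Dec (okV v)) (r₀ : Fin nV) where
    HP : Fin nV → Fin nV → Set
    HP = HPath D okV okD

    len : ∀ {v w} → HP v w → ℕ
    len stop           = 0
    len (go _ _ _ ρ) = suc (len ρ)

    first-step : ∀ {v w} (π : HP v w) → v ≢ w →
      Σ (Fin n) λ d → vert d ≡ v × okD d × okV (vert (α' d)) ×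
        Σ (HP (vert (α' d)) w) λ ρ → suc (len ρ) ≡ len π
    first-step stop             v≢w = ⊥-elim (v≢w refl)
    first-step (go d od ov ρ) _   = d , refl , od , ov , ρ , refl

    PathOfLength : Fin nV → ℕ → Set
    PathOfLength v k = Σ (HP v r₀) λ π → len π ≡ k

    record BFSTree : Set where
      field
        rank      : Fin nV → ℕ
        parent    : Fin nV → Fin n
        parent-ok : ∀ v → okV v → v ≢ r₀ →
          vert (parent v) ≡ v × okD (parent v) × okV (vert (α' (parent v))) ×
          rank (vert (α' (parent v))) < rank v

    module FromShortest (shortest : ∀ v → okV v → ∃ (Least (PathOfLength v))) where
      rank : Fin nV → ℕ
      rank v with okV? v
      ... | yes o = proj₁ (shortest v o)
      ... | no  _ = 0

      parent : Fin nV → Fin n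
      parent v with okV? v | v ≟F r₀
      ... | yes o | no v≢r₀ = proj₁ (first-step (proj₁ (proj₁ (proj₂ (shortest v o)))) v≢r₀)
      ... | _     | _       = proj₁ (vert-surj v)

      rank-shortest : ∀ u → okV u → (ρ : HP u r₀) → rank u ≤ len ρ
      rank-shortest u o ρ with okV? u
      ... | no ¬o = ⊥-elim (¬o o)
      ... | yes o' with shortest u o'
      ...   | k , _ , shorter with k ≤? len ρ
      ...     | yes k≤ = k≤
      ...     | no k≰  = ⊥-elim (shorter (len ρ) (≰⇒> k≰) (ρ , refl))

      parent-ok : ∀ v → okV v → v ≢ r₀ →
        vert (parent v) ≡ v × okD (parent v) × okV (vert (α' (parent v))) ×
        rank (vert (α' (parent v))) < rank v
      parent-ok v o v≢r₀ with okV? v | v ≟F r₀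
      ... | no ¬o   | _       = ⊥-elim (¬o o)
      ... | yes _   | yes e   = ⊥-elim (v≢r₀ e)
      ... | yes o'  | no v≢r₀' with shortest v o'
      ...   | k , (π , lπ) , _ with first-step π v≢r₀'
      ...     | d , at , od , ov , ρ , lρ =
                at , od , ov , ≤-trans (s≤s (rank-shortest (vert (α' d)) ov ρ)) (≤-reflexive (trans lρ lπ))

      bfsTree : BFSTree
      bfsTree = record { rank = rank ; parent = parent ; parent-ok = parent-ok }

    ¬¬-bfsTree : (∀ v → okV v → ¬ ¬ HP v r₀) → ¬ ¬ BFSTree
    ¬¬-bfsTree reach = do
      shortest ← ¬¬-Π λ v → shortest-from v (okV? v)
      pure (FromShortest.bfsTree shortest)
      where
      shortest-from : ∀ v → Dec (okV v) → ¬ ¬ (okV v → ∃ (Least (PathOfLength v)))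
      shortest-from v (no ¬o) = pure (λ o → ⊥-elim (¬o o))
      shortest-from v (yes o) = do
        π ← reach v o
        m ← ¬¬-least (PathOfLength v) (len π) (π , refl)
        pure (λ _ → m)

  -- (B) Two arcs with the same ordered pair of side faces form a 2-edge-cut:
  -- otherwise a spanning tree of H − {d, d'} leaves both arcs in the
  -- cotree, and d bypasses d'.
  repeated-arc : ∀ d d' → out d ≡ true → out d' ≡ true → d ≢ d' →
    face d ≡ face d' → face (α' d) ≡ face (α' d') → ¬ ¬ TwoEdgeCut D d d'
  repeated-arc d d' tail tail' d≢d' same same' no-cut = ¬¬-bfsTree reach contradiction
    where
    open BFS (λ _ → ⊤) (NotOneOf D d d') (λ _ → yes tt) (vert d)

    reach : ∀ v → ⊤ → ¬ ¬ HP v (vert d)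
    reach v _ no-path = no-cut ((λ e → d≢d' (sym e)) , tail≢α-tail d' d tail' tail , v , vert d , no-path)

    spanning : BFSTree → SpanningTree
    spanning bfs = record
      { root = vert d ; parent = parent ; rank = rank
      ; parent-at   = λ v vr → proj₁ (parent-ok v tt vr)
      ; parent-rank = λ v vr → proj₂ (proj₂ (proj₂ (parent-ok v tt vr))) }
      where open BFSTree bfs

    contradiction : BFSTree → ⊥
    contradiction bfs = cotree-no-bypass d' cot-d' bypass
      where
      open BFSTree bfs
      open Cotree (spanning bfs)

      allowed : ∀ v → v ≢ vert d → NotOneOf D d d' (parent v)
      allowed v vr = proj₁ (proj₂ (parent-ok v tt vr))

      cot-d : Cotree d
      cot-d (v , vr , inj₁ e) = proj₁ (allowed v vr) (sym e)
      cot-d (v , vr , inj₂ e) = proj₁ (proj₂ (allowed v vr)) (α-swap (sym e))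

      cot-d' : Cotree d'
      cot-d' (v , vr , inj₁ e) = proj₁ (proj₂ (proj₂ (allowed v vr))) (sym e)
      cot-d' (v , vr , inj₂ e) = proj₂ (proj₂ (proj₂ (allowed v vr))) (α-swap (sym e))

      bypass : DPath (Bypass Cotree d') (face d') (face (α' d'))
      bypass = subst₂ (DPath (Bypass Cotree d')) same same'
                 (dfwd d (cot-d , d≢d' , tail≢α-tail d d' tail tail') dstop)

  -- (A) A vertex x met twice on the boundary of one face is a cut-vertex:
  -- otherwise take a spanning tree of H whose only edge at x is some t;
  -- walking around x from one corner to the other bypasses a cotree arc.
  module RepeatedCorner (loopless : HLoopless D) (c c' : Fin n)
                        (same-vert : vert c ≡ vert c') (same-face : face c ≡ face c') (c≢c' : c ≢ c') where
    x : Fin nV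
    x = vert c

    t : Fin n
    t = proj₁ (vert-surj x)

    t-at : vert t ≡ x
    t-at = proj₂ (vert-surj x)

    r₀ : Fin nV
    r₀ = vert (α' t)

    r₀≢x : r₀ ≢ x
    r₀≢x e = loopless t (trans t-at (sym e))

    open BFS (λ v → v ≢ x) (λ _ → ⊤) (λ v → ¬? (v ≟F x)) r₀

    reach : ¬ CutVertex D x → ∀ v → v ≢ x → ¬ ¬ HP v r₀
    reach no-cut v v≢x no-path = no-cut (v , r₀ , v≢x , r₀≢x , no-path)

    module WithTree (bfs : BFSTree) (fr : FirstReturn t) where
      open BFSTree bfs

      -- The BFS tree of H − x, with x hung from r₀ by the arc t.
      rankAt : ∀ v → Dec (v ≡ x) → ℕ
      rankAt v (yes _) = suc (rank r₀)
      rankAt v (no _)  = rank v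

      parentAt : ∀ v → Dec (v ≡ x) → Fin n
      parentAt v (yes _) = t
      parentAt v (no _)  = parent v

      rank-off-x : ∀ v → v ≢ x → rankAt v (v ≟F x) ≡ rank v
      rank-off-x v v≢x with v ≟F x
      ... | yes e = ⊥-elim (v≢x e)
      ... | no _  = refl

      parentAt-at : ∀ v → v ≢ r₀ → (v? : Dec (v ≡ x)) → vert (parentAt v v?) ≡ v
      parentAt-at v _  (yes e)   = trans t-at (sym e)
      parentAt-at v vr (no v≢x) = proj₁ (parent-ok v v≢x vr)

      parentAt-rank : ∀ v → v ≢ r₀ → (v? : Dec (v ≡ x)) →
        rankAt (vert (α' (parentAt v v?))) (vert (α' (parentAt v v?)) ≟F x) < rankAt v v?
      parentAt-rank v vr (yes _)   = ≤-reflexive (cong suc (rank-off-x r₀ r₀≢x))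
      parentAt-rank v vr (no v≢x) =
        subst (_< rank v) (sym (rank-off-x _ (proj₁ (proj₂ (proj₂ (parent-ok v v≢x vr))))))
              (proj₂ (proj₂ (proj₂ (parent-ok v v≢x vr))))

      tree : SpanningTree
      tree = record
        { root = r₀
        ; parent = λ v → parentAt v (v ≟F x)
        ; rank   = λ v → rankAt v (v ≟F x)
        ; parent-at   = λ v vr → parentAt-at v vr (v ≟F x)
        ; parent-rank = λ v vr → parentAt-rank v vr (v ≟F x) }

      open Cotree tree
      open FirstReturn fr
      open Around fr

      only-t : ∀ d → vert d ≡ x → ∀ v → v ≢ r₀ → (v? : Dec (v ≡ x)) →
        (d ≡ parentAt v v? ⊎ d ≡ α' (parentAt v v?)) → d ≡ t
      only-t d at v vr (yes _)   (inj₁ e) = e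
      only-t d at v vr (yes _)   (inj₂ e) = ⊥-elim (r₀≢x (trans (cong vert (sym e)) at))
      only-t d at v vr (no v≢x) (inj₁ e) =
        ⊥-elim (v≢x (trans (sym (proj₁ (parent-ok v v≢x vr))) (trans (cong vert (sym e)) at)))
      only-t d at v vr (no v≢x) (inj₂ e) =
        ⊥-elim (proj₁ (proj₂ (proj₂ (parent-ok v v≢x vr))) (trans (cong vert (sym e)) at))

      cotree-around : ∀ k → k < period → Cotree (iter σ' k s)
      cotree-around k k<p (v , vr , tr) =
        fresh k k<p (only-t _ (trans (at-vertex k) t-at) v vr (v ≟F x) tr)

      -- If corners a < b ≤ period lie on one face, the darts strictly between
      -- them bypass the cotree arc at a.
      distinct-faces : ∀ a b → a < b → b ≤ period → face (iter σ' a s) ≢ face (iter σ' b s)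
      distinct-faces a b a<b b≤p same-ab =
        cotree-no-bypass e (cotree-around a (<-≤-trans a<b b≤p)) (reverseD around-e)
        where
        e : Fin n
        e = iter σ' a s

        walk : ∀ m i → i + m ≡ b → a < i → DPath (Bypass Cotree e) (face (iter σ' i s)) (face (iter σ' b s))
        walk zero    i i≡b _   =
          subst (λ z → DPath (Bypass Cotree e) (face (iter σ' i s)) (face (iter σ' z s)))
                (trans (sym (+-identityʳ i)) i≡b) dstop
        walk (suc m) i i+m≡b a<i = dfwd cᵢ (cotree-around i i<p , cᵢ≢e , cᵢ≢αe)
          (subst (λ z → DPath (Bypass Cotree e) z (face (iter σ' b s))) (sym (face-ασ cᵢ))
            (walk m (suc i) (trans (sym (+-suc i m)) i+m≡b) (≤-trans a<i (n≤1+n i))))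
          where
          cᵢ : Fin n
          cᵢ = iter σ' i s
          i<p : i < period
          i<p = <-≤-trans (subst (i <_) i+m≡b (m<m+n i z<s)) b≤p
          cᵢ≢e : cᵢ ≢ e
          cᵢ≢e q = distinct a i a<i (<⇒≤ i<p) (sym q)
          cᵢ≢αe : cᵢ ≢ α' e
          cᵢ≢αe q = loopless e (trans (at-vertex a) (sym (trans (cong vert (sym q)) (at-vertex i))))

        around-e : DPath (Bypass Cotree e) (face (α' e)) (face e)
        around-e = subst₂ (DPath (Bypass Cotree e)) (sym (face-ασ e)) (sym same-ab)
                     (walk (b ∸ suc a) (suc a) (m+[n∸m]≡n a<b) ≤-refl)

      position : ∀ d → vert d ≡ x → ∃[ a ] (a ≤ period × iter σ' a s ≡ d)
      position d at with Equivalence.to (vert-orbit s d) (trans (vert-σ t) (trans t-at (sym at)))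
      ... | k , e with reduce k
      ...   | a , a≤p , e' = a , a≤p , trans e' e

      contradiction : ⊥
      contradiction with position c refl | position c' (sym same-vert)
      ... | a , a≤p , ea | b , b≤p , eb with <-cmp a b
      ...   | tri< a<b _ _ = distinct-faces a b a<b b≤p
                               (trans (cong face ea) (trans same-face (cong face (sym eb))))
      ...   | tri≈ _ a≡b _ = c≢c' (trans (sym ea) (trans (cong (λ z → iter σ' z s) a≡b) eb))
      ...   | tri> _ _ b<a = distinct-faces b a b<a a≤p
                               (trans (cong face eb) (trans (sym same-face) (cong face (sym ea))))

    refuted : ¬ ¬ CutVertex D x
    refuted no-cut = ¬¬-bfsTree (reach no-cut) λ bfs → ¬¬-firstReturn t (WithTree.contradiction bfs)

  repeated-corner : HLoopless D → ∀ c c' → vert c ≡ vert c' → face c ≡ face c' → c ≢ c' →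
    ¬ ¬ CutVertex D (vert c)
  repeated-corner = RepeatedCorner.refuted

open DirectedEulerianSphericalEmbedding using (n; nV)

proposition2p5 : (D : DirectedEulerianSphericalEmbedding) →
    HLoopless D →
    (∀ (x : Fin (nV D)) → ¬ CutVertex D x) →
    (∀ (d₁ d₂ : Fin (n D)) → ¬ TwoEdgeCut D d₁ d₂) →
    Simple (triangulationGraph D)
proposition2p5 D loopless no-cut-vertex no-2-edge-cut = no-loop , no-parallel
  where
  open DirectedEulerianSphericalEmbedding D using (vert; face)
  open Multigraph (triangulationGraph D) using (ends)
  open Map D

  no-loop : ∀ e → proj₁ (ends e) ≢ proj₂ (ends e)
  no-loop (inj₁ _)          ()
  no-loop (inj₂ (d , tail)) e = tail-faces-differ d d tail tail (inj₂-injective e)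

  no-parallel : ∀ e e' → SameEnds (ends e) (ends e') → e ≡ e'
  no-parallel (inj₁ c) (inj₁ c') (inj₁ (same-vert , same-face)) with c ≟F c'
  ... | yes c≡c' = cong inj₁ c≡c'
  ... | no c≢c' = ⊥-elim (repeated-corner loopless c c' (inj₁-injective same-vert)
                     (inj₂-injective same-face) c≢c' (no-cut-vertex (vert c)))
  no-parallel (inj₂ (d , tail)) (inj₂ (d' , tail')) (inj₁ (same , same')) with d ≟F d'
  ... | yes refl = cong (λ t → inj₂ (d , t)) (Decidable⇒UIP.≡-irrelevant _≟B_ tail tail')
  ... | no d≢d' = ⊥-elim (repeated-arc d d' tail tail' d≢d' (inj₂-injective same)
                     (inj₂-injective same') (no-2-edge-cut d d'))
  no-parallel (inj₂ (d , tail)) (inj₂ (d' , tail')) (inj₂ (crossed , _)) =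
    ⊥-elim (tail-faces-differ d d' tail tail' (inj₂-injective crossed))
  no-parallel (inj₁ _) (inj₁ _) (inj₂ (() , _))
  no-parallel (inj₁ _) (inj₂ _) (inj₁ (() , _))
  no-parallel (inj₁ _) (inj₂ _) (inj₂ (() , _))
  no-parallel (inj₂ _) (inj₁ _) (inj₁ (() , _))
  no-parallel (inj₂ _) (inj₁ _) (inj₂ (_ , ()))
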